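{- The measure $r$ is not monotone: it is not the case that $r(v)\le r(v{\tt x})$ for every word $v$ and every letter ${\tt x}$.
   Context: For a word $w$ over a finite ordered alphabet, $\mathrm{BWT}(w)$ is obtained by sorting the conjugates $w[i..n-1]w[0..i-1]$ lexicographically and concatenating their last characters; $r(w)$ is the number of maximal equal-letter runs of $\mathrm{BWT}(w)$. A measure $\lambda$ on words is monotone if $\lambda(v)\le\lambda(v{\tt x})$ for every word $v$ and every letter ${\tt x}$. -}

module Defs where

open import Data.Nat using (ℕ; zero; suc; _<ᵇ_; _≡ᵇ_)
open import Data.Bool using (Bool; true; false; if_then_else_)
open import Data.List using (List; []; _∷_; _++_; map; drop; take; length; upTo)

-- Words over the ordered alphabet ℕ (natural order); any finite alphabet embeds.
Word : Set
Word = List ℕ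

lexLeq : Word → Word → Bool
lexLeq [] _ = true
lexLeq (x ∷ xs) [] = false
lexLeq (x ∷ xs) (y ∷ ys) =
  if x <ᵇ y then true else (if x ≡ᵇ y then lexLeq xs ys else false)

insert : Word → List Word → List Word
insert u [] = u ∷ []
insert u (v ∷ vs) = if lexLeq u v then u ∷ v ∷ vs else v ∷ insert u vs

sortWords : List Word → List Word
sortWords [] = []
sortWords (u ∷ us) = insert u (sortWords us)

rotate : ℕ → Word → Word
rotate i w = drop i w ++ take i w

conjugates : Word → List Word
conjugates w = map (λ i → rotate i w) (upTo (length w))

-- Last letter (conjugates are nonempty, so the default is never used).
lastLetter : Word → ℕ
lastLetter [] = 0
lastLetter (x ∷ []) = x
lastLetter (x ∷ y ∷ ys) = lastLetter (y ∷ ys)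

BWT : Word → Word
BWT w = map lastLetter (sortWords (conjugates w))

runsFrom : ℕ → Word → ℕ
runsFrom x [] = 1
runsFrom x (y ∷ ys) = if x ≡ᵇ y then runsFrom y ys else suc (runsFrom y ys)

runs : Word → ℕ
runs [] = 0
runs (x ∷ xs) = runsFrom x xs

r : Word → ℕ
r w = runs (BWT w)

{-# OPTIONS --safe #-}
module Submission where

open import Defs
open import Data.Nat using (ℕ; _≤_; _<_)
open import Data.Nat.Properties using (<⇒≱; n<1+n)
open import Data.List using (_∷ʳ_; _∷_; [])
open import Relation.Binary.PropositionalEquality using (_≡_; refl; sym; cong; subst₂)
open import Relation.Nullary using (¬_)

-- The letters a < b < c are encoded as 0 < 1 < 2.
aabb : Word
aabb = 0 ∷ 0 ∷ 1 ∷ 1 ∷ []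

BWT-aabb : BWT aabb ≡ 1 ∷ 0 ∷ 1 ∷ 0 ∷ []
BWT-aabb = refl

BWT-aabbc : BWT (aabb ∷ʳ 2) ≡ 2 ∷ 0 ∷ 0 ∷ 1 ∷ 1 ∷ []
BWT-aabbc = refl

r-aabb : r aabb ≡ 4
r-aabb = cong runs BWT-aabb

r-aabbc : r (aabb ∷ʳ 2) ≡ 3
r-aabbc = cong runs BWT-aabbc

r-aabbc<r-aabb : r (aabb ∷ʳ 2) < r aabb
r-aabbc<r-aabb = subst₂ _<_ (sym r-aabbc) (sym r-aabb) (n<1+n 3)

corollary1 : ¬ ((v : Word) → (x : ℕ) → r v ≤ r (v ∷ʳ x))
corollary1 monotone = <⇒≱ r-aabbc<r-aabb (monotone aabb 2)
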